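{- Let $\Pi_{42}$ be the map on $\mathbb{N}=\{1,2,3,\dots\}$ produced by the following procedure, with $L(m)=R(m)=\lfloor (m+1)/2\rfloor$. At step $1$ set $\Pi_{42}(1)=1$. For $m=2,3,4,\dots$ in turn, at step $m$: if $\Pi_{42}(m-L(m))$ has not been assigned at an earlier step, set $\Pi_{42}(m-L(m))=m$; otherwise set $\Pi_{42}(m+R(m))=m$. Let $\sigma$ be the morphism on $\{2,3,4,5\}^*$ given by $\sigma(2)=232$, $\sigma(3)=234$, $\sigma(4)=234$, $\sigma(5)=524$, and let $s=s_1s_2s_3\dots=524232234\dots$ be its fixed point starting with $5$. Then for all $n>1$: $s_n=2$ iff $\Pi_{42}(n)$ has type (II); $s_n=3$ iff $\Pi_{42}(n)$ has type (III); $s_n=4$ iff $\Pi_{42}(n)$ has type (IV).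
   Context: The procedure assigns a value $\Pi_{42}(n)$ to every $n\in\mathbb{N}$. Types: $\Pi_{42}(n)$ has type (II) if $\Pi_{42}(n)>n$ and $\Pi_{42}(n)=2n$; type (III) if $\Pi_{42}(n)<n$ and $\Pi_{42}(n)=(2n-1)/3$; type (IV) if $\Pi_{42}(n)<n$ and $\Pi_{42}(n)=2n/3$. -}

module Defs where

open import Data.Nat using (ℕ; zero; suc; _+_; _*_; _∸_; _<_; _≡ᵇ_; ⌊_/2⌋)
open import Data.Bool using (Bool; true; false; if_then_else_)
open import Data.List using (List; []; _∷_; _++_; concatMap)
open import Data.Bool.ListAction using (any)
open import Data.Maybe using (Maybe; just; nothing)
open import Relation.Binary.PropositionalEquality using (_≡_)
open import Data.Product using (_×_)

L : ℕ → ℕ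
L m = ⌊ suc m /2⌋

R : ℕ → ℕ
R m = ⌊ suc m /2⌋

lastOr0 : List ℕ → ℕ
lastOr0 []           = 0
lastOr0 (x ∷ [])     = x
lastOr0 (x ∷ y ∷ xs) = lastOr0 (y ∷ xs)

-- placed k = [p₁, …, p_k] where p_m is the position assigned (value m)
-- at step m of the procedure: p₁ = 1, and for m ≥ 2,
-- p_m = m - L(m) if that position is not among p₁ … p_{m-1},
-- otherwise p_m = m + R(m).
placed : ℕ → List ℕ
placed zero          = []
placed (suc zero)    = 1 ∷ []
placed (suc (suc k)) =
  let m  = suc (suc k)
      ps = placed (suc k)
      p  = m ∸ L m
  in ps ++ ((if any (λ q → q ≡ᵇ p) ps then m + R m else p) ∷ [])

pos : ℕ → ℕ
pos m = lastOr0 (placed m)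

-- Π₄₂(n): the step m at which position n is assigned.
-- Position n = ⌊2n/2⌋ = 2n - L(2n) is assigned at step 2n at the latest,
-- so it suffices to search steps 1 … 2n (default 0 if not found).
searchStep : ℕ → ℕ → ℕ → ℕ
searchStep n zero       m = 0
searchStep n (suc fuel) m = if pos m ≡ᵇ n then m else searchStep n fuel (suc m)

Π42 : ℕ → ℕ
Π42 n = searchStep n (2 * n) 1

TypeII : ℕ → Set
TypeII n = (n < Π42 n) × (Π42 n ≡ 2 * n)

-- Π₄₂(n) = (2n-1)/3  ⇔  3 Π₄₂(n) + 1 = 2n
TypeIII : ℕ → Set
TypeIII n = (Π42 n < n) × (3 * Π42 n + 1 ≡ 2 * n)

-- Π₄₂(n) = 2n/3  ⇔  3 Π₄₂(n) = 2n
TypeIV : ℕ → Set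
TypeIV n = (Π42 n < n) × (3 * Π42 n ≡ 2 * n)

data Sym : Set where
  two three four five : Sym

σ : Sym → List Sym
σ two   = two ∷ three ∷ two ∷ []
σ three = two ∷ three ∷ four ∷ []
σ four  = two ∷ three ∷ four ∷ []
σ five  = five ∷ two ∷ four ∷ []

σ* : List Sym → List Sym
σ* = concatMap σ

σ^ : ℕ → List Sym
σ^ zero    = five ∷ []
σ^ (suc k) = σ* (σ^ k)

-- 1-indexed lookup, default five when out of range / index 0
nth1 : List Sym → ℕ → Sym
nth1 []       _             = five
nth1 (x ∷ xs) zero          = five
nth1 (x ∷ xs) (suc zero)    = x
nth1 (x ∷ xs) (suc (suc i)) = nth1 xs (suc i)

-- s_n (n ≥ 1): σⁿ(5) is a prefix of the fixed point of length 3ⁿ ≥ n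
s : ℕ → Sym
s n = nth1 (σ^ n) n

-- Call m the step prescribed for the position p if s_p = 2 and m = 2p,
-- s_p = 3 and 3m + 1 = 2p, s_p = 4 and 3m = 2p, or p = m = 1.  As s is the
-- fixed point of σ, for k ≥ 1 we have s_{3k+1} = 2, s_{3k+2} = 3, and s_{3k}
-- is 2 if s_k is and 4 otherwise.  Hence every position p has exactly one
-- prescribed step, which is 2p if s_p = 2 and smaller otherwise, and every
-- step is prescribed for at most one position.  By strong induction, step m
-- of the procedure writes the position it is prescribed for: at m = 2j or
-- 2j + 1 the procedure first tries ⌊m/2⌋ = j.  If m = 2j and s_j = 2, no
-- earlier step is prescribed for j, so j is free and gets written.  In every
-- other case j was written at its earlier prescribed step, and the procedure
-- writes m + ⌈m/2⌉, which is 3j or 3j + 2, the position m is prescribed for.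
-- So Π₄₂(n) is the step prescribed for n, and for n > 1 that is the type
-- matching s_n.

module Submission where

open import Defs
open import Data.Nat using (_<_)
open import Data.Product using (_×_)
open import Function.Bundles using (_⇔_)
open import Relation.Binary.PropositionalEquality using (_≡_)

open import Data.Bool using (T; true; false; if_then_else_)
open import Data.Bool.Properties using (T-≡; ¬-not; if-cong)
open import Data.Bool.ListAction using (any)
open import Data.Empty using (⊥; ⊥-elim)
open import Data.Fin using (Fin; zero; suc; toℕ)
open import Data.Fin.Properties using (toℕ<n)
open import Data.List using ([]; _∷_; _++_; length)
open import Data.List.Properties using (length-++; concatMap-++)
open import Data.List.Relation.Unary.Any using (Any; here)
open import Data.List.Relation.Unary.Any.Properties using (any⁺; any⁻; ++⁺ˡ; ++⁺ʳ; ++⁻)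
open import Data.Nat using (ℕ; zero; suc; >-nonZero; _+_; _*_; _∸_; _≤_; z≤n; s≤s; _≡ᵇ_; ⌊_/2⌋; ⌈_/2⌉)
open import Data.Nat.DivMod using (_divMod_; result)
open import Data.Nat.Induction using (<-rec)
open import Data.Nat.Properties
open import Data.Nat.Tactic.RingSolver using (solve-∀)
open import Data.Product using (_,_; proj₁; proj₂; ∃-syntax)
open import Data.Sum using (inj₁; inj₂)
open import Function.Base using (_∘_)
open import Function.Bundles using (mk⇔; Equivalence)
open import Relation.Binary.PropositionalEquality using (refl; sym; trans; cong; cong₂; subst; _≢_; module ≡-Reasoning)
open import Relation.Nullary using (¬_; Dec; yes; no; contradiction)

-- The letters of s

σ-at : Sym → Fin 3 → Sym
σ-at x r = nth1 (σ x) (suc (toℕ r))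

length-σ : ∀ x → length (σ x) ≡ 3
length-σ two   = refl
length-σ three = refl
length-σ four  = refl
length-σ five  = refl

length-σ* : ∀ xs → length (σ* xs) ≡ length xs * 3
length-σ* []       = refl
length-σ* (x ∷ xs) = trans (length-++ (σ x)) (cong₂ _+_ (length-σ x) (length-σ* xs))

σ*-in-range : ∀ xs j (r : Fin 3) → j < length xs → suc (j * 3 + toℕ r) ≤ length (σ* xs)
σ*-in-range xs j r j< = begin
  suc (j * 3 + toℕ r)  ≡⟨ cong suc (+-comm (j * 3) (toℕ r)) ⟩
  suc (toℕ r + j * 3)  ≤⟨ +-monoˡ-< (j * 3) (toℕ<n r) ⟩
  suc j * 3            ≤⟨ *-monoˡ-≤ 3 j< ⟩
  length xs * 3        ≡⟨ length-σ* xs ⟨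
  length (σ* xs)       ∎
  where open ≤-Reasoning

nth1-++ˡ : ∀ xs ys i → i ≤ length xs → nth1 (xs ++ ys) i ≡ nth1 xs i
nth1-++ˡ []       []       zero          _         = refl
nth1-++ˡ []       (_ ∷ _)  zero          _         = refl
nth1-++ˡ (x ∷ xs) ys       zero          _         = refl
nth1-++ˡ (x ∷ xs) ys       (suc zero)    _         = refl
nth1-++ˡ (x ∷ xs) ys       (suc (suc i)) (s≤s i≤) = nth1-++ˡ xs ys (suc i) i≤

nth1-++ʳ : ∀ xs ys i → nth1 (xs ++ ys) (suc (length xs + i)) ≡ nth1 ys (suc i)
nth1-++ʳ []       ys i = refl
nth1-++ʳ (x ∷ xs) ys i = nth1-++ʳ xs ys i

nth1-σ* : ∀ xs j (r : Fin 3) → j < length xs →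
          nth1 (σ* xs) (suc (j * 3 + toℕ r)) ≡ σ-at (nth1 xs (suc j)) r
nth1-σ* (x ∷ xs) zero    r _ =
  nth1-++ˡ (σ x) (σ* xs) (suc (toℕ r)) (subst (suc (toℕ r) ≤_) (sym (length-σ x)) (toℕ<n r))
nth1-σ* (x ∷ xs) (suc j) r (s≤s j<) = begin
  nth1 (σ x ++ σ* xs) (suc (3 + (j * 3 + toℕ r)))
    ≡⟨ cong (λ l → nth1 (σ x ++ σ* xs) (suc (l + (j * 3 + toℕ r)))) (length-σ x) ⟨
  nth1 (σ x ++ σ* xs) (suc (length (σ x) + (j * 3 + toℕ r)))
    ≡⟨ nth1-++ʳ (σ x) (σ* xs) _ ⟩
  nth1 (σ* xs) (suc (j * 3 + toℕ r))
    ≡⟨ nth1-σ* xs j r j< ⟩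
  σ-at (nth1 xs (suc j)) r ∎
  where open ≡-Reasoning

σ^-prefix : ∀ {k l} → k ≤ l → ∃[ zs ] σ^ l ≡ σ^ k ++ zs
σ^-prefix {l = zero}  z≤n = [] , refl
σ^-prefix {l = suc l} z≤n with σ^-prefix {l = l} z≤n
... | zs , eq = two ∷ four ∷ σ* zs , cong σ* eq
σ^-prefix {suc k} (s≤s k≤l) with σ^-prefix k≤l
... | zs , eq = σ* zs , trans (cong σ* eq) (concatMap-++ σ (σ^ k) zs)

k<length-σ^ : ∀ k → k < length (σ^ k)
k<length-σ^ zero    = s≤s z≤n
k<length-σ^ (suc k) = begin-strict
  suc k                ≤⟨ k<L ⟩
  length (σ^ k)        <⟨ m<m*n _ 3 ⦃ >-nonZero (≤-<-trans z≤n k<L) ⦄ (s≤s (s≤s z≤n)) ⟩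
  length (σ^ k) * 3    ≡⟨ length-σ* (σ^ k) ⟨
  length (σ^ (suc k))  ∎
  where
  open ≤-Reasoning
  k<L = k<length-σ^ k

nth1-σ^-stable : ∀ {k l} i → k ≤ l → i ≤ length (σ^ k) → nth1 (σ^ l) i ≡ nth1 (σ^ k) i
nth1-σ^-stable {k} i k≤l i≤ with σ^-prefix k≤l
... | zs , eq = trans (cong (λ xs → nth1 xs i) eq) (nth1-++ˡ (σ^ k) zs i i≤)

nth1-σ^≡s : ∀ k i → i ≤ length (σ^ k) → nth1 (σ^ k) i ≡ s i
nth1-σ^≡s k i i≤ with ≤-total k i
... | inj₁ k≤i = sym (nth1-σ^-stable i k≤i i≤)
... | inj₂ i≤k = nth1-σ^-stable i i≤k (<⇒≤ (k<length-σ^ i))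

s-σ : ∀ j (r : Fin 3) → s (suc (toℕ r + j * 3)) ≡ σ-at (s (suc j)) r
s-σ j r = begin
  s (suc (toℕ r + j * 3))
    ≡⟨ cong (s ∘ suc) (+-comm (toℕ r) (j * 3)) ⟩
  s (suc (j * 3 + toℕ r))
    ≡⟨ nth1-σ^≡s (suc (suc j)) _ (σ*-in-range (σ^ (suc j)) j r j<) ⟨
  nth1 (σ^ (suc (suc j))) (suc (j * 3 + toℕ r))
    ≡⟨ nth1-σ* (σ^ (suc j)) j r j< ⟩
  σ-at (s (suc j)) r ∎
  where
  open ≡-Reasoning
  j< : j < length (σ^ (suc j))
  j< = <⇒≤ (k<length-σ^ (suc j))

σ-at≡five : ∀ x r → σ-at x r ≡ five → x ≡ five × r ≡ zero
σ-at≡five five  zero             _  = refl , refl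
σ-at≡five five  (suc zero)       ()
σ-at≡five five  (suc (suc zero)) ()
σ-at≡five two   zero             ()
σ-at≡five two   (suc zero)       ()
σ-at≡five two   (suc (suc zero)) ()
σ-at≡five three zero             ()
σ-at≡five three (suc zero)       ()
σ-at≡five three (suc (suc zero)) ()
σ-at≡five four  zero             ()
σ-at≡five four  (suc zero)       ()
σ-at≡five four  (suc (suc zero)) ()

σ-at-non-five : ∀ x → x ≢ five → σ-at x zero ≡ two × σ-at x (suc zero) ≡ three
σ-at-non-five two   _  = refl , refl
σ-at-non-five three _  = refl , refl
σ-at-non-five four  _  = refl , refl
σ-at-non-five five  ne = ⊥-elim (ne refl)

σ-at-last-non-two : ∀ x → x ≢ two → σ-at x (suc (suc zero)) ≡ four
σ-at-last-non-two two   ne = ⊥-elim (ne refl)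
σ-at-last-non-two three _  = refl
σ-at-last-non-two four  _  = refl
σ-at-last-non-two five  _  = refl

s≢five : ∀ m → 1 ≤ m → s (suc m) ≢ five
s≢five = <-rec (λ m → 1 ≤ m → s (suc m) ≢ five) step
  where
  step : ∀ m → (∀ {k} → k < m → 1 ≤ k → s (suc k) ≢ five) → 1 ≤ m → s (suc m) ≢ five
  step m rec 1≤m s≡five with m divMod 3
  ... | result q r refl with σ-at≡five (s (suc q)) r (trans (sym (s-σ q r)) s≡five)
  step _ rec () _ | result zero    _ refl | _ , refl
  step _ rec _  _ | result (suc k) _ refl | e , refl =
    rec (m<m*n (suc k) 3 (s≤s (s≤s z≤n))) (s≤s z≤n) e

s[3k+4]≡two : ∀ k → s (suc (suc k * 3)) ≡ two
s[3k+4]≡two k =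
  trans (s-σ (suc k) zero) (proj₁ (σ-at-non-five _ (s≢five (suc k) (s≤s z≤n))))

s[3k+5]≡three : ∀ k → s (suc (suc (suc k * 3))) ≡ three
s[3k+5]≡three k =
  trans (s-σ (suc k) (suc zero)) (proj₂ (σ-at-non-five _ (s≢five (suc k) (s≤s z≤n))))

s[3k+3]≡two : ∀ k → s (suc k) ≡ two → s (suc k * 3) ≡ two
s[3k+3]≡two k e = trans (s-σ k (suc (suc zero))) (cong (λ x → σ-at x (suc (suc zero))) e)

s[3k+3]≡four : ∀ k → s (suc k) ≢ two → s (suc k * 3) ≡ four
s[3k+3]≡four k ne = trans (s-σ k (suc (suc zero))) (σ-at-last-non-two _ ne)

-- The steps prescribed by s

data Prescribes : Sym → ℕ → ℕ → Set where
  type-II  : ∀ {p m} → m ≡ 2 * p → Prescribes two p m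
  type-III : ∀ {p m} → 3 * m + 1 ≡ 2 * p → Prescribes three p m
  type-IV  : ∀ {p m} → 3 * m ≡ 2 * p → Prescribes four p m
  initial  : Prescribes five 1 1

Assigns : ℕ → ℕ → Set
Assigns m p = Prescribes (s p) p m

assigns : ∀ {x m p} → s p ≡ x → Prescribes x p m → Assigns m p
assigns {m = m} {p} e = subst (λ y → Prescribes y p m) (sym e)

two? : ∀ x → Dec (x ≡ two)
two? two   = yes refl
two? three = no λ ()
two? four  = no λ ()
two? five  = no λ ()

3[2j]≡2[3j] : ∀ j → 3 * (j * 2) ≡ 2 * (j * 3)
3[2j]≡2[3j] = solve-∀

3[2j+1]+1≡2[3j+2] : ∀ j → 3 * suc (j * 2) + 1 ≡ 2 * suc (suc (j * 3))
3[2j+1]+1≡2[3j+2] = solve-∀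

Assigns-exists : ∀ p → 1 ≤ p → ∃[ m ] Assigns m p
Assigns-exists (suc p) _ with two? (s (suc p))
... | yes e = 2 * suc p , assigns e (type-II refl)
... | no ne with p divMod 3
...   | result zero    zero             refl = 1 , initial
...   | result (suc k) zero             refl = ⊥-elim (ne (s[3k+4]≡two k))
...   | result zero    (suc zero)       refl = ⊥-elim (ne refl)
...   | result (suc k) (suc zero)       refl =
  suc (suc k * 2) , assigns (s[3k+5]≡three k) (type-III (3[2j+1]+1≡2[3j+2] (suc k)))
...   | result q       (suc (suc zero)) refl =
  suc q * 2 , assigns (s[3k+3]≡four q (ne ∘ s[3k+3]≡two q)) (type-IV (3[2j]≡2[3j] (suc q)))

3m+1≡2n⇒m<n : ∀ {m n} → 3 * m + 1 ≡ 2 * n → m < n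
3m+1≡2n⇒m<n {m} {n} e = *-cancelˡ-< 3 m n (begin-strict
  3 * m      <⟨ m<m+n (3 * m) (s≤s z≤n) ⟩
  3 * m + 1  ≡⟨ e ⟩
  2 * n      ≤⟨ *-monoˡ-≤ n (n≤1+n 2) ⟩
  3 * n      ∎)
  where open ≤-Reasoning

3m≡2n⇒m<n : ∀ {m n} → 1 ≤ n → 3 * m ≡ 2 * n → m < n
3m≡2n⇒m<n {m} {suc n} _ e = *-cancelˡ-< 3 m (suc n) (begin-strict
  3 * m      ≡⟨ e ⟩
  2 * suc n  <⟨ *-monoˡ-< (suc n) (n<1+n 2) ⟩
  3 * suc n  ∎)
  where open ≤-Reasoning

prescribed-step< : ∀ {x p m} → 1 ≤ p → x ≢ two → Prescribes x p m → m < 2 * p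
prescribed-step< _ ne (type-II _) = ⊥-elim (ne refl)
prescribed-step< {p = p} _ _ (type-III e) = <-≤-trans (3m+1≡2n⇒m<n e) (m≤m+n p (1 * p))
prescribed-step< {p = p} 1≤p _ (type-IV e) = <-≤-trans (3m≡2n⇒m<n 1≤p e) (m≤m+n p (1 * p))
prescribed-step< _ _ initial = s≤s (s≤s z≤n)

prescribed-step≤ : ∀ {x p m} → 1 ≤ p → Prescribes x p m → m ≤ 2 * p
prescribed-step≤ _   (type-II e) = ≤-reflexive e
prescribed-step≤ 1≤p pr@(type-III _) = <⇒≤ (prescribed-step< 1≤p (λ ()) pr)
prescribed-step≤ 1≤p pr@(type-IV _)  = <⇒≤ (prescribed-step< 1≤p (λ ()) pr)
prescribed-step≤ 1≤p pr@initial      = <⇒≤ (prescribed-step< 1≤p (λ ()) pr)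

prescribed-step-positive : ∀ {x p m} → 1 ≤ p → Prescribes x p m → 1 ≤ m
prescribed-step-positive {m = suc _}           _  _            = s≤s z≤n
prescribed-step-positive {p = zero}            () _
prescribed-step-positive {p = suc _} {zero}    _  (type-II ())
prescribed-step-positive {p = suc p} {zero}    _  (type-III e) = ⊥-elim (even≢odd (suc p) 0 (sym e))
prescribed-step-positive {p = suc _} {zero}    _  (type-IV ())

prescribed-step-unique : ∀ {x p m m′} → Prescribes x p m → Prescribes x p m′ → m ≡ m′
prescribed-step-unique (type-II e)  (type-II e′)  = trans e (sym e′)
prescribed-step-unique (type-III e) (type-III e′) =
  *-cancelˡ-≡ _ _ 3 (+-cancelʳ-≡ 1 _ _ (trans e (sym e′)))
prescribed-step-unique (type-IV e)  (type-IV e′)  = *-cancelˡ-≡ _ _ 3 (trans e (sym e′))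
prescribed-step-unique initial      initial       = refl

no-step-two-three : ∀ {m p q} → Prescribes two p m → Prescribes three q m → ⊥
no-step-two-three {p = p} {q} (type-II refl) (type-III e) = even≢odd q (3 * p) (trans (sym e) (lemma p))
  where
  lemma : ∀ p → 3 * (2 * p) + 1 ≡ suc (2 * (3 * p))
  lemma = solve-∀

no-step-two-four : ∀ {m p q} → s p ≡ two → s q ≡ four →
                   Prescribes two p m → Prescribes four q m → ⊥
no-step-two-four {p = zero} () _ _ _  -- s 0 is the default letter five of nth1
no-step-two-four {p = suc k} {q} s[p]≡2 s[q]≡4 (type-II refl) (type-IV e) =
  contradiction (trans (sym (s[3k+3]≡two k s[p]≡2)) (subst (λ n → s n ≡ four) q≡3p s[q]≡4)) λ ()
  where
  lemma : ∀ k → 3 * (2 * suc k) ≡ 2 * (suc k * 3)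
  lemma = solve-∀
  q≡3p : q ≡ suc k * 3
  q≡3p = *-cancelˡ-≡ q (suc k * 3) 2 (trans (sym e) (lemma k))

no-step-two-five : ∀ {m p q} → Prescribes two p m → Prescribes five q m → ⊥
no-step-two-five {p = p} (type-II e) initial = even≢odd p 0 (sym e)

no-step-three-four : ∀ {m p q} → Prescribes three p m → Prescribes four q m → ⊥
no-step-three-four {m} {p} {q} (type-III e) (type-IV e′) =
  even≢odd p q (trans (sym e) (trans (+-comm (3 * m) 1) (cong suc e′)))

no-step-three-five : ∀ {m p q} → s p ≡ three → Prescribes three p m → Prescribes five q m → ⊥
no-step-three-five {p = p} s[p]≡3 (type-III e) initial =
  contradiction (subst (λ n → s n ≡ three) (sym (*-cancelˡ-≡ 2 p 2 e)) s[p]≡3) λ ()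

no-step-four-five : ∀ {m p q} → Prescribes four p m → Prescribes five q m → ⊥
no-step-four-five {p = p} (type-IV e) initial = even≢odd p 1 (sym e)

prescribed-position-unique : ∀ {x y m p q} → s p ≡ x → s q ≡ y →
                             Prescribes x p m → Prescribes y q m → p ≡ q
prescribed-position-unique _  _  (type-II a)  (type-II b)  = *-cancelˡ-≡ _ _ 2 (trans (sym a) b)
prescribed-position-unique _  _  (type-III a) (type-III b) = *-cancelˡ-≡ _ _ 2 (trans (sym a) b)
prescribed-position-unique _  _  (type-IV a)  (type-IV b)  = *-cancelˡ-≡ _ _ 2 (trans (sym a) b)
prescribed-position-unique _  _  initial      initial      = refl
prescribed-position-unique _  _  a@(type-II _)  b@(type-III _) = ⊥-elim (no-step-two-three a b)
prescribed-position-unique _  _  a@(type-III _) b@(type-II _)  = ⊥-elim (no-step-two-three b a)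
prescribed-position-unique ep eq a@(type-II _)  b@(type-IV _)  = ⊥-elim (no-step-two-four ep eq a b)
prescribed-position-unique ep eq a@(type-IV _)  b@(type-II _)  = ⊥-elim (no-step-two-four eq ep b a)
prescribed-position-unique _  _  a@(type-II _)  b@initial      = ⊥-elim (no-step-two-five a b)
prescribed-position-unique _  _  a@initial      b@(type-II _)  = ⊥-elim (no-step-two-five b a)
prescribed-position-unique _  _  a@(type-III _) b@(type-IV _)  = ⊥-elim (no-step-three-four a b)
prescribed-position-unique _  _  a@(type-IV _)  b@(type-III _) = ⊥-elim (no-step-three-four b a)
prescribed-position-unique ep _  a@(type-III _) b@initial      = ⊥-elim (no-step-three-five ep a b)
prescribed-position-unique _  eq a@initial      b@(type-III _) = ⊥-elim (no-step-three-five eq b a)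
prescribed-position-unique _  _  a@(type-IV _)  b@initial      = ⊥-elim (no-step-four-five a b)
prescribed-position-unique _  _  a@initial      b@(type-IV _)  = ⊥-elim (no-step-four-five b a)

Assigns-position-unique : ∀ {m p q} → Assigns m p → Assigns m q → p ≡ q
Assigns-position-unique = prescribed-position-unique refl refl

-- The procedure follows the prescription

lastOr0-∷ʳ : ∀ xs x → lastOr0 (xs ++ x ∷ []) ≡ x
lastOr0-∷ʳ []           x = refl
lastOr0-∷ʳ (_ ∷ [])     x = refl
lastOr0-∷ʳ (_ ∷ y ∷ xs) x = lastOr0-∷ʳ (y ∷ xs) x

placed-suc : ∀ m → placed (suc m) ≡ placed m ++ pos (suc m) ∷ []
placed-suc zero    = refl
placed-suc (suc m) = cong (λ x → placed (suc m) ++ x ∷ []) (sym (lastOr0-∷ʳ (placed (suc m)) _))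

Occupied : ℕ → ℕ → Set
Occupied m p = ∃[ i ] 1 ≤ i × i ≤ m × pos i ≡ p

Occupied⇒Any : ∀ m {p} → Occupied m p → Any (λ q → T (q ≡ᵇ p)) (placed m)
Occupied⇒Any zero    (_ , () , z≤n , _)
Occupied⇒Any (suc m) (i , 1≤i , i≤1+m , e) rewrite placed-suc m with m≤n⇒m<n∨m≡n i≤1+m
... | inj₁ i<1+m = ++⁺ˡ (Occupied⇒Any m (i , 1≤i , m<1+n⇒m≤n i<1+m , e))
... | inj₂ refl  = ++⁺ʳ (placed m) (here (≡⇒≡ᵇ _ _ e))

Any⇒Occupied : ∀ m {p} → Any (λ q → T (q ≡ᵇ p)) (placed m) → Occupied m p
Any⇒Occupied zero    ()
Any⇒Occupied (suc m) a rewrite placed-suc m with ++⁻ (placed m) a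
... | inj₁ a′ with Any⇒Occupied m a′
...   | i , 1≤i , i≤m , e = i , 1≤i , m≤n⇒m≤1+n i≤m , e
Any⇒Occupied (suc m) a | inj₂ (here t) = suc m , s≤s z≤n , ≤-refl , ≡ᵇ⇒≡ _ _ t

Occupied⇔any : ∀ m {p} → Occupied m p ⇔ (any (λ q → q ≡ᵇ p) (placed m) ≡ true)
Occupied⇔any m = mk⇔ (Equivalence.to T-≡ ∘ any⁺ _ ∘ Occupied⇒Any m)
                     (Any⇒Occupied m ∘ any⁻ _ _ ∘ Equivalence.from T-≡)

pos-suc-suc : ∀ k → let m = suc (suc k) in
  pos m ≡ (if any (λ q → q ≡ᵇ (m ∸ L m)) (placed (suc k)) then m + R m else m ∸ L m)
pos-suc-suc k = lastOr0-∷ʳ (placed (suc k)) _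

pos-fresh : ∀ k {p} → suc (suc k) ∸ L (suc (suc k)) ≡ p → ¬ Occupied (suc k) p →
            pos (suc (suc k)) ≡ p
pos-fresh k refl free =
  trans (pos-suc-suc k) (if-cong (¬-not (free ∘ Equivalence.from (Occupied⇔any (suc k)))))

pos-taken : ∀ k {p} → suc (suc k) ∸ L (suc (suc k)) ≡ p → Occupied (suc k) p →
            pos (suc (suc k)) ≡ suc (suc k) + R (suc (suc k))
pos-taken k refl occ =
  trans (pos-suc-suc k) (if-cong (Equivalence.to (Occupied⇔any (suc k)) occ))

m∸L[m]≡⌊m/2⌋ : ∀ m → m ∸ L m ≡ ⌊ m /2⌋
m∸L[m]≡⌊m/2⌋ m = begin
  m ∸ ⌈ m /2⌉                  ≡⟨ cong (_∸ ⌈ m /2⌉) (⌊n/2⌋+⌈n/2⌉≡n m) ⟨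
  ⌊ m /2⌋ + ⌈ m /2⌉ ∸ ⌈ m /2⌉  ≡⟨ m+n∸n≡m ⌊ m /2⌋ ⌈ m /2⌉ ⟩
  ⌊ m /2⌋                      ∎
  where open ≡-Reasoning

⌊j*2/2⌋≡j : ∀ j → ⌊ j * 2 /2⌋ ≡ j
⌊j*2/2⌋≡j zero    = refl
⌊j*2/2⌋≡j (suc j) = cong suc (⌊j*2/2⌋≡j j)

⌊1+j*2/2⌋≡j : ∀ j → ⌊ suc (j * 2) /2⌋ ≡ j
⌊1+j*2/2⌋≡j zero    = refl
⌊1+j*2/2⌋≡j (suc j) = cong suc (⌊1+j*2/2⌋≡j j)

2j∸L[2j]≡j : ∀ j → suc j * 2 ∸ L (suc j * 2) ≡ suc j
2j∸L[2j]≡j j = trans (m∸L[m]≡⌊m/2⌋ _) (cong suc (⌊j*2/2⌋≡j j))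

2j+1∸L[2j+1]≡j : ∀ j → suc (suc j * 2) ∸ L (suc (suc j * 2)) ≡ suc j
2j+1∸L[2j+1]≡j j = trans (m∸L[m]≡⌊m/2⌋ _) (cong suc (⌊1+j*2/2⌋≡j j))

2j+R[2j]≡3j : ∀ j → suc j * 2 + R (suc j * 2) ≡ suc j * 3
2j+R[2j]≡3j j = trans (cong (λ h → suc j * 2 + suc h) (⌊1+j*2/2⌋≡j j)) (lemma j)
  where
  lemma : ∀ j → suc j * 2 + suc j ≡ suc j * 3
  lemma = solve-∀

2j+1+R[2j+1]≡3j+2 : ∀ j → suc (suc j * 2) + R (suc (suc j * 2)) ≡ suc (suc (suc j * 3))
2j+1+R[2j+1]≡3j+2 j = trans (cong (λ h → suc (suc j * 2) + suc (suc h)) (⌊j*2/2⌋≡j j)) (lemma j)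
  where
  lemma : ∀ j → suc (suc j * 2) + suc (suc j) ≡ suc (suc (suc j * 3))
  lemma = solve-∀

AssignsUpTo : ℕ → Set
AssignsUpTo k = ∀ i → 1 ≤ i → i ≤ k → Assigns i (pos i)

assigned-by : ∀ {k w p} → AssignsUpTo k → 1 ≤ p → Assigns w p → w ≤ k → Occupied k p
assigned-by ih 1≤p A w≤k = _ , 1≤w , w≤k , Assigns-position-unique (ih _ 1≤w w≤k) A
  where 1≤w = prescribed-step-positive 1≤p A

pos-even-step : ∀ j → AssignsUpTo (suc (j * 2)) → Assigns (suc j * 2) (pos (suc j * 2))
pos-even-step j ih with two? (s (suc j))
... | yes s≡2 = subst (Assigns (suc j * 2)) (sym (pos-fresh (j * 2) (2j∸L[2j]≡j j) untaken)) A
  where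
  A : Assigns (suc j * 2) (suc j)
  A = assigns s≡2 (type-II (*-comm (suc j) 2))
  untaken : ¬ Occupied (suc (j * 2)) (suc j)
  untaken (i , 1≤i , i≤ , e) =
    <-irrefl (prescribed-step-unique (subst (Assigns i) e (ih i 1≤i i≤)) A) (s≤s i≤)
... | no s≢2 with Assigns-exists (suc j) (s≤s z≤n)
...   | w , A = subst (Assigns (suc j * 2))
                  (sym (trans (pos-taken (j * 2) (2j∸L[2j]≡j j) taken) (2j+R[2j]≡3j j)))
                  (assigns (s[3k+3]≡four j s≢2) (type-IV (3[2j]≡2[3j] (suc j))))
  where
  taken : Occupied (suc (j * 2)) (suc j)
  taken = assigned-by ih (s≤s z≤n) A
            (m<1+n⇒m≤n (subst (w <_) (*-comm 2 (suc j)) (prescribed-step< (s≤s z≤n) s≢2 A)))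

pos-odd-step : ∀ j → AssignsUpTo (suc j * 2) → Assigns (suc (suc j * 2)) (pos (suc (suc j * 2)))
pos-odd-step j ih with Assigns-exists (suc j) (s≤s z≤n)
... | w , A = subst (Assigns (suc (suc j * 2)))
                (sym (trans (pos-taken (suc (j * 2)) (2j+1∸L[2j+1]≡j j) taken) (2j+1+R[2j+1]≡3j+2 j)))
                (assigns (s[3k+5]≡three j) (type-III (3[2j+1]+1≡2[3j+2] (suc j))))
  where
  taken : Occupied (suc j * 2) (suc j)
  taken = assigned-by ih (s≤s z≤n) A
            (subst (w ≤_) (*-comm 2 (suc j)) (prescribed-step≤ (s≤s z≤n) A))

pos-assigns : ∀ m → 1 ≤ m → Assigns m (pos m)
pos-assigns = <-rec (λ m → 1 ≤ m → Assigns m (pos m)) step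
  where
  step : ∀ m → (∀ {i} → i < m → 1 ≤ i → Assigns i (pos i)) → 1 ≤ m → Assigns m (pos m)
  step m rec 1≤m with m divMod 2
  step _ rec () | result zero    zero       refl
  step _ rec _  | result zero    (suc zero) refl = initial
  step _ rec _  | result (suc j) zero       refl = pos-even-step j λ i 1≤i i≤ → rec (s≤s i≤) 1≤i
  step _ rec _  | result (suc j) (suc zero) refl = pos-odd-step j λ i 1≤i i≤ → rec (s≤s i≤) 1≤i

-- Π₄₂ and the types

searchStep-first : ∀ n fuel m v → m ≤ v → v < m + fuel → pos v ≡ n →
                   (∀ i → m ≤ i → i < v → pos i ≢ n) → searchStep n fuel m ≡ v
searchStep-first n zero m v m≤v v< _ _ =
  ⊥-elim (<-irrefl refl (<-≤-trans (subst (v <_) (+-identityʳ m) v<) m≤v))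
searchStep-first n (suc fuel) m v m≤v v< pv earlier with pos m ≡ᵇ n in eq | m≤n⇒m<n∨m≡n m≤v
... | true  | inj₂ m≡v = m≡v
... | true  | inj₁ m<v = ⊥-elim (earlier m ≤-refl m<v (≡ᵇ⇒≡ _ _ (subst T (sym eq) _)))
... | false | inj₂ refl = ⊥-elim (subst T eq (≡⇒≡ᵇ _ _ pv))
... | false | inj₁ m<v =
  searchStep-first n fuel (suc m) v m<v (subst (v <_) (+-suc m fuel) v<) pv
    (λ i m<i → earlier i (<⇒≤ m<i))

Π42-assigns : ∀ n → 1 ≤ n → Assigns (Π42 n) n
Π42-assigns n 1≤n with Assigns-exists n 1≤n
... | w , A = subst (λ v → Assigns v n) (sym Π42≡w) A
  where
  Π42≡w : Π42 n ≡ w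
  Π42≡w = searchStep-first n (2 * n) 1 w
    (prescribed-step-positive 1≤n A)
    (s≤s (prescribed-step≤ 1≤n A))
    (Assigns-position-unique (pos-assigns w (prescribed-step-positive 1≤n A)) A)
    (λ i 1≤i i<w e → <-irrefl (prescribed-step-unique (subst (Assigns i) e (pos-assigns i 1≤i)) A) i<w)

HasType : Sym → ℕ → Set
HasType two   = TypeII
HasType three = TypeIII
HasType four  = TypeIV
HasType five  = λ _ → ⊥

prescribed⇒HasType : ∀ {x n} → 1 < n → Prescribes x n (Π42 n) → HasType x n
prescribed⇒HasType {n = n} 1<n (type-II e) = subst (n <_) (sym e) n<2n , e
  where
  n<2n : n < 2 * n
  n<2n = subst (n <_) (*-comm n 2) (m<m*n n 2 ⦃ >-nonZero (<⇒≤ 1<n) ⦄ (s≤s (s≤s z≤n)))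
prescribed⇒HasType 1<n (type-III e) = 3m+1≡2n⇒m<n e , e
prescribed⇒HasType 1<n (type-IV e)  = 3m≡2n⇒m<n (<⇒≤ 1<n) e , e
prescribed⇒HasType 1<n initial      = <-irrefl refl 1<n

HasType-unique : ∀ x y {n} → HasType x n → HasType y n → x ≡ y
HasType-unique two   two   _ _ = refl
HasType-unique three three _ _ = refl
HasType-unique four  four  _ _ = refl
HasType-unique two   three (n<Π , _) (Π<n , _) = ⊥-elim (<-asym n<Π Π<n)
HasType-unique three two   (Π<n , _) (n<Π , _) = ⊥-elim (<-asym n<Π Π<n)
HasType-unique two   four  (n<Π , _) (Π<n , _) = ⊥-elim (<-asym n<Π Π<n)
HasType-unique four  two   (Π<n , _) (n<Π , _) = ⊥-elim (<-asym n<Π Π<n)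
HasType-unique three four  (_ , e) (_ , e′) = ⊥-elim (1+n≢n (trans (+-comm 1 _) (trans e (sym e′))))
HasType-unique four  three (_ , e′) (_ , e) = ⊥-elim (1+n≢n (trans (+-comm 1 _) (trans e (sym e′))))
HasType-unique five  _     () _
HasType-unique _     five  _ ()

theorem7 : ∀ n → 1 < n →
    ((s n ≡ two) ⇔ TypeII n) × ((s n ≡ three) ⇔ TypeIII n) × ((s n ≡ four) ⇔ TypeIV n)
theorem7 n 1<n = letter⇔type two , letter⇔type three , letter⇔type four
  where
  typed : HasType (s n) n
  typed = prescribed⇒HasType 1<n (Π42-assigns n (<⇒≤ 1<n))
  letter⇔type : ∀ x → (s n ≡ x) ⇔ HasType x n
  letter⇔type x = mk⇔ (λ e → subst (λ y → HasType y n) e typed) (HasType-unique (s n) x typed)
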